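{- Let $k \geq 2$ be a natural number and let $F$ be a rooted directed forest on $n \geq 1$ vertices. Then $\psi_b(F,k) \geq \frac{n+k}{2k}$. Moreover, this lower bound is tight: whenever $n \geq 1$ is such that $\frac{n+k}{2k}$ is an integer, there exists a rooted directed forest $F$ on $n$ vertices with $\psi_b(F,k) = \frac{n+k}{2k}$.
   Context: A rooted directed forest is a disjoint union of rooted trees in which every edge is oriented away from the root of its tree. A leaf is a vertex of out-degree $0$ (this includes isolated vertices), and a branching vertex is a vertex of out-degree at least $2$. A directed path on $k$ vertices is a directed path of length $k-1$. A set $P$ of vertices of $F$ is a branching $k$-path vertex cover of $F$ if every leaf of $F$ belongs to $P$ and every directed path on $k$ vertices in $F$ contains a branching vertex or a vertex of $P$. The branching $k$-path vertex cover number $\psi_b(F,k)$ is the minimum size of a branching $k$-path vertex cover of $F$. -}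

module Defs where

open import Data.Nat using (ℕ; zero; suc; _+_; _*_; _≤_)
open import Data.Fin using (Fin)
open import Data.Fin.Subset using (Subset; _∈_; ∣_∣)
open import Data.Maybe using (Maybe; just; nothing; _>>=_)
open import Data.Vec using (Vec; []; _∷_)
open import Data.Vec.Relation.Unary.Any using (Any)
open import Data.Product using (Σ; ∃; ∃-syntax; _×_; _,_)
open import Data.Sum using (_⊎_)
open import Data.Unit using (⊤)
open import Relation.Binary.PropositionalEquality using (_≡_; _≢_)
open import Relation.Nullary using (¬_)

ancestor : ∀ {n} → (Fin n → Maybe (Fin n)) → ℕ → Fin n → Maybe (Fin n)
ancestor p zero    v = just v
ancestor p (suc d) v = ancestor p d v >>= p

-- A rooted directed forest on vertex set Fin n, given by its parent map:
-- parent v = nothing iff v is a root; otherwise there is an edge parent v → v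
-- (edges oriented away from the root).
record Forest (n : ℕ) : Set where
  field
    parent  : Fin n → Maybe (Fin n)
    acyclic : ∀ v → ∃[ d ] (ancestor parent d v ≡ nothing)
open Forest public

Child : ∀ {n} → Forest n → Fin n → Fin n → Set
Child F v u = parent F u ≡ just v

Leaf : ∀ {n} → Forest n → Fin n → Set
Leaf F v = ¬ (∃[ u ] Child F v u)

Branching : ∀ {n} → Forest n → Fin n → Set
Branching F v = ∃[ u ] ∃[ w ] (u ≢ w × Child F v u × Child F v w)

DirPath : ∀ {n m} → Forest n → Vec (Fin n) m → Set
DirPath F []           = ⊤
DirPath F (x ∷ [])     = ⊤
DirPath F (x ∷ y ∷ vs) = Child F x y × DirPath F (y ∷ vs)

IsBPVC : ∀ {n} → Forest n → ℕ → Subset n → Set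
IsBPVC {n} F k P =
  (∀ v → Leaf F v → v ∈ P) ×
  (∀ (vs : Vec (Fin n) k) → DirPath F vs →
     Any (λ v → Branching F v ⊎ v ∈ P) vs)

IsPsiB : ∀ {n} → Forest n → ℕ → ℕ → Set
IsPsiB F k m =
  (∃[ P ] (IsBPVC F k P × ∣ P ∣ ≡ m)) ×
  (∀ P → IsBPVC F k P → m ≤ ∣ P ∣)

{-# OPTIONS --safe #-}
-- Let P be a branching k-path vertex cover and B the number of branching vertices. The out-degrees
-- sum to n minus the number of roots, which forces B to be smaller than the number of leaves, so
-- B < |P|. Call a vertex free if it lies outside P and has exactly one child; at most |P| + B ≤ 2|P| - 1
-- vertices are not free. Free vertices are not branching, so a directed path of free vertices has
-- fewer than k vertices. Let c i count the vertices whose i nearest ancestors are all free. Double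
-- counting along the parent map (a free vertex has a single child) shows that c 1 is the number of
-- free vertices and that c i - c (i + 1) is at most the number of non-free vertices, while c k = 0.
-- Hence there are at most (k - 1)(2|P| - 1) free vertices, and n ≤ k(2|P| - 1).
--
-- Equality holds for a comb with r + 1 leaves and r branching vertices in which every vertex is
-- replaced by a directed path of k vertices: its n = (2r + 1)k vertices are covered by the r + 1
-- bottoms of the paths that replace leaves.
module Submission where

open import Defs
import Data.Nat.Properties
open import Algebra.Properties.Semiring.Sum Data.Nat.Properties.+-*-semiring
  using (sum; sum-syntax; sum-cong-≗; sum-remove; sum-replicate-zero; ∑-comm; ∑-distrib-+; *-distribʳ-sum)
open import Data.Bool using (if_then_else_)
open import Data.Empty using (⊥-elim)
open import Data.Fin as Fin
  using (Fin; zero; suc; toℕ; fromℕ; inject₁; combine; remQuot; punchIn; punchOut)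
  renaming (_<_ to _<ᶠ_)
open import Data.Fin.Properties
  using (suc-injective; punchInᵢ≢i; punchIn-punchOut; remQuot-combine; combine-surjective; combine-injective;
         combine-injectiveˡ; combine-monoˡ-<; toℕ-combine; toℕ-inject₁; fromℕ≢inject₁; inject₁-injective; toℕ<n)
open import Data.Fin.Relation.Unary.Top using (view; ‵fromℕ; ‵inj₁)
open import Data.Fin.Subset using (Subset; inside; outside; _∈_; _∉_; ∣_∣; ⁅_⁆; _∪_) renaming (⊥ to ∅)
open import Data.Fin.Subset.Properties using (_∈?_; x∈p∪q⁺; x∈⁅x⁆; ∣⊥∣≡0; ∣⁅x⁆∣≡1; ∣p∣≤∣x∷p∣)
open import Data.Maybe as Maybe using (Maybe; just; nothing; maybe)
open import Data.Maybe.Properties using (≡-dec; just-injective)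
import Data.Maybe.Relation.Unary.Any as MaybeAny
open import Data.Nat
open import Data.Nat.Divisibility using (_∣_; divides)
open import Data.Nat.Properties hiding (suc-injective)
open import Data.Nat.Tactic.RingSolver using (solve-∀)
open import Data.Product using (Σ; ∃-syntax; _×_; _,_; proj₁; proj₂; uncurry)
open import Data.Sum using (_⊎_; inj₁; inj₂; [_,_]′)
open import Data.Unit using (⊤; tt)
open import Data.Vec using (Vec; []; _∷_)
open import Data.Vec.Functional using (removeAt)
open import Data.Vec.Relation.Unary.All using (All; []; _∷_; lookupWith)
open import Data.Vec.Relation.Unary.Any as Any using (Any; here; there)
open import Function using (_∘_; _⇔_; Equivalence; mk⇔)
open import Level using (Level)
open import Relation.Binary.PropositionalEquality
open import Relation.Nullary using (Dec; yes; no; does; ¬_; ¬?; contradiction; _×-dec_)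
open import Relation.Unary using (Pred; Decidable)

private
  variable
    a b c : Level
    A : Set a
    B : Set b
    C : Set c

  _≟ᵐ_ : ∀ {n} (x y : Maybe (Fin n)) → Dec (x ≡ y)
  _≟ᵐ_ = ≡-dec Fin._≟_

-- Counting over Fin n

-- Defined through does, so that 𝟙 commutes definitionally with Dec.map′, ×-dec and ¬?.
𝟙 : Dec A → ℕ
𝟙 a? = if does a? then 1 else 0

𝟙-yes : (a? : Dec A) → A → 𝟙 a? ≡ 1
𝟙-yes (yes _) _ = refl
𝟙-yes (no ¬a) a = contradiction a ¬a

𝟙-no : (a? : Dec A) → ¬ A → 𝟙 a? ≡ 0
𝟙-no (yes a) ¬a = contradiction a ¬a
𝟙-no (no _)  _  = refl

𝟙-mono : (A → B) → (a? : Dec A) (b? : Dec B) → 𝟙 a? ≤ 𝟙 b?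
𝟙-mono A⇒B (yes a) b? = ≤-reflexive (sym (𝟙-yes b? (A⇒B a)))
𝟙-mono A⇒B (no _)  b? = z≤n

𝟙-cong : A ⇔ B → (a? : Dec A) (b? : Dec B) → 𝟙 a? ≡ 𝟙 b?
𝟙-cong A⇔B a? b? = ≤-antisym (𝟙-mono to a? b?) (𝟙-mono from b? a?)
  where open Equivalence A⇔B

𝟙-split : (a? : Dec A) (b? : Dec B) →
          𝟙 a? ≡ 𝟙 (b? ×-dec a?) + 𝟙 (¬? b? ×-dec a?)
𝟙-split (yes _) (yes _) = refl
𝟙-split (yes _) (no _)  = refl
𝟙-split (no _)  (yes _) = refl
𝟙-split (no _)  (no _)  = refl

𝟙-⊎ : (A → B ⊎ C) →
      (a? : Dec A) (b? : Dec B) (c? : Dec C) → 𝟙 a? ≤ 𝟙 b? + 𝟙 c?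
𝟙-⊎ A⇒B⊎C (no _)  b? c? = z≤n
𝟙-⊎ A⇒B⊎C (yes a) b? c? with A⇒B⊎C a
... | inj₁ b = ≤-trans (≤-reflexive (sym (𝟙-yes b? b))) (m≤m+n _ _)
... | inj₂ c = ≤-trans (≤-reflexive (sym (𝟙-yes c? c))) (m≤n+m _ _)

∑-mono-≤ : ∀ {n} {f g : Fin n → ℕ} → (∀ i → f i ≤ g i) → sum f ≤ sum g
∑-mono-≤ {zero}  f≤g = z≤n
∑-mono-≤ {suc n} f≤g = +-mono-≤ (f≤g zero) (∑-mono-≤ (f≤g ∘ suc))

∑-const-1 : ∀ n → ∑[ i < n ] 1 ≡ n
∑-const-1 zero    = refl
∑-const-1 (suc n) = cong suc (∑-const-1 n)

∑-zero : ∀ {n} {f : Fin n → ℕ} → (∀ i → f i ≡ 0) → sum f ≡ 0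
∑-zero {n} f≡0 = trans (sum-cong-≗ f≡0) (sum-replicate-zero n)

term≤∑ : ∀ {n} (f : Fin n → ℕ) i → f i ≤ sum f
term≤∑ {suc n} f i = ≤-trans (m≤m+n (f i) (sum (removeAt f i))) (≤-reflexive (sym (sum-remove {i = i} f)))

two-terms≤∑ : ∀ {n} (f : Fin n → ℕ) {i j} → i ≢ j → f i + f j ≤ sum f
two-terms≤∑ {suc n} f {i} {j} i≢j = begin
  f i + f j                          ≡⟨ cong (λ x → f i + f x) (punchIn-punchOut i≢j) ⟨
  f i + removeAt f i (punchOut i≢j)  ≤⟨ +-monoʳ-≤ (f i) (term≤∑ (removeAt f i) _) ⟩
  f i + sum (removeAt f i)           ≡⟨ sum-remove f ⟨
  sum f                              ∎
  where open ≤-Reasoning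

∑<n : ∀ {n} (f : Fin n → ℕ) i → (∀ j → f j ≤ 1) → f i ≡ 0 → sum f < n
∑<n {suc n} f i f≤1 fi≡0 = s≤s (begin
  sum f                     ≡⟨ sum-remove f ⟩
  f i + sum (removeAt f i)  ≡⟨ cong (_+ sum (removeAt f i)) fi≡0 ⟩
  sum (removeAt f i)        ≤⟨ ∑-mono-≤ (f≤1 ∘ punchIn i) ⟩
  ∑[ j < n ] 1              ≡⟨ ∑-const-1 n ⟩
  n                         ∎)
  where open ≤-Reasoning

count : ∀ {n p} {P : Pred (Fin n) p} → Decidable P → ℕ
count {n} P? = ∑[ i < n ] 𝟙 (P? i)

module _ {n p q} {P : Pred (Fin n) p} {Q : Pred (Fin n) q} where

  count-mono : (∀ i → P i → Q i) → (P? : Decidable P) (Q? : Decidable Q) → count P? ≤ count Q?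
  count-mono P⇒Q P? Q? = ∑-mono-≤ (λ i → 𝟙-mono (P⇒Q i) (P? i) (Q? i))

  count-cong : (∀ i → P i ⇔ Q i) → (P? : Decidable P) (Q? : Decidable Q) → count P? ≡ count Q?
  count-cong P⇔Q P? Q? = sum-cong-≗ (λ i → 𝟙-cong (P⇔Q i) (P? i) (Q? i))

  count-split : (P? : Decidable P) (Q? : Decidable Q) →
                count P? ≡ count (λ i → Q? i ×-dec P? i) + count (λ i → ¬? (Q? i) ×-dec P? i)
  count-split P? Q? = trans (sum-cong-≗ (λ i → 𝟙-split (P? i) (Q? i)))
                            (∑-distrib-+ (λ i → 𝟙 (Q? i ×-dec P? i)) (λ i → 𝟙 (¬? (Q? i) ×-dec P? i)))

  count-∪ : ∀ {r} {R : Pred (Fin n) r} → (∀ i → P i → Q i ⊎ R i) →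
            (P? : Decidable P) (Q? : Decidable Q) (R? : Decidable R) → count P? ≤ count Q? + count R?
  count-∪ P⇒Q⊎R P? Q? R? = begin
    count P?                            ≤⟨ ∑-mono-≤ (λ i → 𝟙-⊎ (P⇒Q⊎R i) (P? i) (Q? i) (R? i)) ⟩
    ∑[ i < n ] (𝟙 (Q? i) + 𝟙 (R? i))   ≡⟨ ∑-distrib-+ (𝟙 ∘ Q?) (𝟙 ∘ R?) ⟩
    count Q? + count R?                 ∎
    where open ≤-Reasoning


count-∅ : ∀ {n p} {P : Pred (Fin n) p} → (∀ i → ¬ P i) → (P? : Decidable P) → count P? ≡ 0
count-∅ ¬P P? = ∑-zero (λ i → 𝟙-no (P? i) (¬P i))

count+count-complement : ∀ {n p} {P : Pred (Fin n) p} (P? : Decidable P) → count P? + count (¬? ∘ P?) ≡ n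
count+count-complement {n} P? = begin
  count P? + count (¬? ∘ P?)             ≡⟨ ∑-distrib-+ (𝟙 ∘ P?) (𝟙 ∘ ¬? ∘ P?) ⟨
  ∑[ i < n ] (𝟙 (P? i) + 𝟙 (¬? (P? i)))  ≡⟨ sum-cong-≗ (λ i → 𝟙+𝟙¬ (P? i)) ⟩
  ∑[ i < n ] 1                           ≡⟨ ∑-const-1 n ⟩
  n                                      ∎
  where
  open ≡-Reasoning
  𝟙+𝟙¬ : (a? : Dec A) → 𝟙 a? + 𝟙 (¬? a?) ≡ 1
  𝟙+𝟙¬ (yes _) = refl
  𝟙+𝟙¬ (no _)  = refl

∣p∣≡count : ∀ {n} (p : Subset n) → ∣ p ∣ ≡ count (_∈? p)
∣p∣≡count []            = refl
∣p∣≡count (inside  ∷ p) = cong suc (∣p∣≡count p)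
∣p∣≡count (outside ∷ p) = ∣p∣≡count p

∣p∪q∣≤∣p∣+∣q∣ : ∀ {n} (p q : Subset n) → ∣ p ∪ q ∣ ≤ ∣ p ∣ + ∣ q ∣
∣p∪q∣≤∣p∣+∣q∣ []            []            = z≤n
∣p∪q∣≤∣p∣+∣q∣ (outside ∷ p) (outside ∷ q) = ∣p∪q∣≤∣p∣+∣q∣ p q
∣p∪q∣≤∣p∣+∣q∣ (outside ∷ p) (inside  ∷ q) =
  subst (suc ∣ p ∪ q ∣ ≤_) (sym (+-suc ∣ p ∣ ∣ q ∣)) (s≤s (∣p∪q∣≤∣p∣+∣q∣ p q))
∣p∪q∣≤∣p∣+∣q∣ (inside  ∷ p) (x       ∷ q) =
  s≤s (≤-trans (∣p∪q∣≤∣p∣+∣q∣ p q) (+-monoʳ-≤ ∣ p ∣ (∣p∣≤∣x∷p∣ x q)))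

image : ∀ {m n} → (Fin m → Fin n) → Subset n
image {zero}  f = ∅
image {suc m} f = ⁅ f zero ⁆ ∪ image (f ∘ suc)

∈-image : ∀ {m n} (f : Fin m → Fin n) i → f i ∈ image f
∈-image f zero    = x∈p∪q⁺ (inj₁ (x∈⁅x⁆ (f zero)))
∈-image f (suc i) = x∈p∪q⁺ (inj₂ (∈-image (f ∘ suc) i))

∣image∣≤ : ∀ {m n} (f : Fin m → Fin n) → ∣ image f ∣ ≤ m
∣image∣≤ {zero}  {n} f = ≤-reflexive (∣⊥∣≡0 n)
∣image∣≤ {suc m}     f = ≤-trans (∣p∪q∣≤∣p∣+∣q∣ ⁅ f zero ⁆ (image (f ∘ suc)))
                                 (+-mono-≤ (≤-reflexive (∣⁅x⁆∣≡1 (f zero))) (∣image∣≤ (f ∘ suc)))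

maybe-as-∑ : ∀ {n} (f : Fin n → ℕ) x → maybe f 0 x ≡ ∑[ v < n ] (𝟙 (x ≟ᵐ just v) * f v)
maybe-as-∑ {n}     f nothing  = sym (sum-replicate-zero n)
maybe-as-∑ {suc n} f (just w) = sym (begin
  ∑[ v < suc n ] term v                   ≡⟨ sum-remove {i = w} term ⟩
  term w + ∑[ j < n ] term (punchIn w j)  ≡⟨ cong₂ _+_ (cong (_* f w) (𝟙-yes (just w ≟ᵐ just w) refl))
                                                       (∑-zero other-terms) ⟩
  1 * f w + 0                             ≡⟨ +-identityʳ (1 * f w) ⟩
  1 * f w                                 ≡⟨ *-identityˡ (f w) ⟩
  f w                                     ∎)
  where
  open ≡-Reasoning
  term : Fin (suc n) → ℕ
  term v = 𝟙 (just w ≟ᵐ just v) * f v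
  other-terms : ∀ j → term (punchIn w j) ≡ 0
  other-terms j = cong (_* f (punchIn w j))
    (𝟙-no (just w ≟ᵐ just (punchIn w j)) (punchInᵢ≢i w j ∘ sym ∘ just-injective))

∑-fibres : ∀ {m n} (p : Fin m → Maybe (Fin n)) (f : Fin n → ℕ) →
           ∑[ u < m ] maybe f 0 (p u) ≡ ∑[ v < n ] (count (λ u → p u ≟ᵐ just v) * f v)
∑-fibres {m} {n} p f = begin
  ∑[ u < m ] maybe f 0 (p u)                        ≡⟨ sum-cong-≗ (maybe-as-∑ f ∘ p) ⟩
  ∑[ u < m ] ∑[ v < n ] (𝟙 (p u ≟ᵐ just v) * f v)  ≡⟨ ∑-comm (λ u v → 𝟙 (p u ≟ᵐ just v) * f v) ⟩
  ∑[ v < n ] ∑[ u < m ] (𝟙 (p u ≟ᵐ just v) * f v)  ≡⟨ sum-cong-≗ (λ v → *-distribʳ-sum (f v) (fibre v)) ⟨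
  ∑[ v < n ] (count (λ u → p u ≟ᵐ just v) * f v)    ∎
  where
  open ≡-Reasoning
  fibre : Fin n → Fin m → ℕ
  fibre v u = 𝟙 (p u ≟ᵐ just v)

Any-just : ∀ {a p} {A : Set a} {P : Pred A p} {x : Maybe A} → MaybeAny.Any P x → ∃[ w ] (x ≡ just w × P w)
Any-just (MaybeAny.just p) = _ , refl , p

map≡just : ∀ {f : A → B} x {y} → Maybe.map f x ≡ just y → ∃[ a ] (x ≡ just a × f a ≡ y)
map≡just (just a) refl = a , refl , refl

ancestor≡nothing⇒root : ∀ {n} (p : Fin n → Maybe (Fin n)) d v → ancestor p d v ≡ nothing → ∃[ w ] p w ≡ nothing
ancestor≡nothing⇒root p (suc d) v eq with ancestor p d v in eq′
... | nothing = ancestor≡nothing⇒root p d v eq′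
... | just w  = w , eq

module _ {n} (F : Forest n) where

  outdeg : Fin n → ℕ
  outdeg v = count (λ u → parent F u ≟ᵐ just v)

  outdeg≡0⇒Leaf : ∀ {v} → outdeg v ≡ 0 → Leaf F v
  outdeg≡0⇒Leaf {v} d≡0 (u , child) = 1+n≰n (begin
    1                          ≡⟨ 𝟙-yes (parent F u ≟ᵐ just v) child ⟨
    𝟙 (parent F u ≟ᵐ just v)   ≤⟨ term≤∑ _ u ⟩
    outdeg v                   ≡⟨ d≡0 ⟩
    0                          ∎)
    where open ≤-Reasoning

  Branching⇒2≤outdeg : ∀ {v} → Branching F v → 2 ≤ outdeg v
  Branching⇒2≤outdeg {v} (u , w , u≢w , u-child , w-child) = begin
    2                                                     ≡⟨ cong₂ _+_ (𝟙-yes (parent F u ≟ᵐ just v) u-child)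
                                                                       (𝟙-yes (parent F w ≟ᵐ just v) w-child) ⟨
    𝟙 (parent F u ≟ᵐ just v) + 𝟙 (parent F w ≟ᵐ just v)  ≤⟨ two-terms≤∑ _ u≢w ⟩
    outdeg v                                              ∎
    where open ≤-Reasoning

  ∑outdeg<n : Fin n → ∑[ v < n ] outdeg v < n
  ∑outdeg<n v₀
    with root , root-parent ← ancestor≡nothing⇒root (parent F) (proj₁ (acyclic F v₀)) v₀ (proj₂ (acyclic F v₀))
    = begin-strict
    ∑[ v < n ] outdeg v        ≡⟨ sum-cong-≗ (λ v → *-identityʳ (outdeg v)) ⟨
    ∑[ v < n ] (outdeg v * 1)  ≡⟨ ∑-fibres (parent F) (λ _ → 1) ⟨
    ∑[ u < n ] hasParent u     <⟨ ∑<n hasParent root hasParent≤1 (cong (maybe (λ _ → 1) 0) root-parent) ⟩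
    n                          ∎
    where
    open ≤-Reasoning
    hasParent : Fin n → ℕ
    hasParent u = maybe (λ _ → 1) 0 (parent F u)
    hasParent≤1 : ∀ u → hasParent u ≤ 1
    hasParent≤1 u with parent F u
    ... | nothing = z≤n
    ... | just _  = ≤-refl

  branchings<leaves : Fin n → count (λ v → 2 ≤? outdeg v) < count (λ v → outdeg v ≟ 0)
  branchings<leaves v₀ = +-cancelˡ-< n #branch #leaf (begin-strict
    n + #branch                               ≡⟨ cong (_+ #branch) (∑-const-1 n) ⟨
    ∑[ v < n ] 1 + #branch                    ≡⟨ ∑-distrib-+ (λ _ → 1) (λ v → 𝟙 (2 ≤? outdeg v)) ⟨
    ∑[ v < n ] (1 + 𝟙 (2 ≤? outdeg v))        ≤⟨ ∑-mono-≤ (λ v → 1+[2≤d]≤d+[d≡0] (outdeg v)) ⟩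
    ∑[ v < n ] (outdeg v + 𝟙 (outdeg v ≟ 0))  ≡⟨ ∑-distrib-+ outdeg (λ v → 𝟙 (outdeg v ≟ 0)) ⟩
    ∑[ v < n ] outdeg v + #leaf               <⟨ +-monoˡ-< #leaf (∑outdeg<n v₀) ⟩
    n + #leaf                                 ∎)
    where
    open ≤-Reasoning
    #branch #leaf : ℕ
    #branch = count (λ v → 2 ≤? outdeg v)
    #leaf   = count (λ v → outdeg v ≟ 0)
    1+[2≤d]≤d+[d≡0] : ∀ d → 1 + 𝟙 (2 ≤? d) ≤ d + 𝟙 (d ≟ 0)
    1+[2≤d]≤d+[d≡0] 0             = ≤-refl
    1+[2≤d]≤d+[d≡0] 1             = ≤-refl
    1+[2≤d]≤d+[d≡0] (suc (suc d)) = s≤s (s≤s z≤n)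

  count-parent∈ : ∀ {q} {Q : Pred (Fin n) q} (Q? : Decidable Q) → (∀ v → Q v → outdeg v ≡ 1) →
                  count (λ u → MaybeAny.dec Q? (parent F u)) ≡ count Q?
  count-parent∈ Q? unary = begin
    ∑[ u < n ] 𝟙 (MaybeAny.dec Q? (parent F u))  ≡⟨ sum-cong-≗ (λ u → 𝟙-Any (parent F u)) ⟩
    ∑[ u < n ] maybe (𝟙 ∘ Q?) 0 (parent F u)     ≡⟨ ∑-fibres (parent F) (𝟙 ∘ Q?) ⟩
    ∑[ v < n ] (outdeg v * 𝟙 (Q? v))             ≡⟨ sum-cong-≗ outdeg*𝟙 ⟩
    count Q?                                     ∎
    where
    open ≡-Reasoning
    𝟙-Any : ∀ x → 𝟙 (MaybeAny.dec Q? x) ≡ maybe (𝟙 ∘ Q?) 0 x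
    𝟙-Any nothing  = refl
    𝟙-Any (just _) = refl
    outdeg*𝟙 : ∀ v → outdeg v * 𝟙 (Q? v) ≡ 𝟙 (Q? v)
    outdeg*𝟙 v with Q? v
    ... | yes q = cong (_* 1) (unary v q)
    ... | no _  = *-zeroʳ (outdeg v)

-- Free vertices and the lower bound

module _ {n} (F : Forest n) (P : Subset n) where

  Free : Fin n → Set
  Free v = v ∉ P × outdeg F v ≡ 1

  free? : Decidable Free
  free? v = ¬? (v ∈? P) ×-dec (outdeg F v ≟ 1)

  FreeAncestors : ℕ → Fin n → Set
  FreeAncestors zero    u = ⊤
  FreeAncestors (suc i) u = MaybeAny.Any (λ w → Free w × FreeAncestors i w) (parent F u)

  freeAncestors? : ∀ i → Decidable (FreeAncestors i)
  freeAncestors? zero    u = yes tt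
  freeAncestors? (suc i) u = MaybeAny.dec (λ w → free? w ×-dec freeAncestors? i w) (parent F u)

  #free #nonfree #branch : ℕ
  #free    = count free?
  #nonfree = count (¬? ∘ free?)
  #branch  = count (λ v → 2 ≤? outdeg F v)

  #freeAncestors : ℕ → ℕ
  #freeAncestors i = count (freeAncestors? i)

  #freeAncestors-suc : ∀ i → #freeAncestors (suc i) ≡ count (λ v → free? v ×-dec freeAncestors? i v)
  #freeAncestors-suc i = count-parent∈ F (λ v → free? v ×-dec freeAncestors? i v) (λ _ → proj₂ ∘ proj₁)

  #freeAncestors-step : ∀ i → #freeAncestors i ≤ #freeAncestors (suc i) + #nonfree
  #freeAncestors-step i = begin
    #freeAncestors i
      ≡⟨ count-split (freeAncestors? i) free? ⟩
    count (λ v → free? v ×-dec freeAncestors? i v) + count (λ v → ¬? (free? v) ×-dec freeAncestors? i v)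
      ≤⟨ +-monoʳ-≤ _ (count-mono (λ _ → proj₁) (λ v → ¬? (free? v) ×-dec freeAncestors? i v) (¬? ∘ free?)) ⟩
    count (λ v → free? v ×-dec freeAncestors? i v) + #nonfree
      ≡⟨ cong (_+ #nonfree) (#freeAncestors-suc i) ⟨
    #freeAncestors (suc i) + #nonfree
      ∎
    where open ≤-Reasoning

  #free≤#freeAncestors : ∀ i → #free ≤ #freeAncestors (suc i) + i * #nonfree
  #free≤#freeAncestors zero = ≤-reflexive (begin-equality
    #free
      ≡⟨ count-cong (λ _ → mk⇔ (_, tt) proj₁) free? (λ v → free? v ×-dec freeAncestors? 0 v) ⟩
    count (λ v → free? v ×-dec freeAncestors? 0 v)
      ≡⟨ #freeAncestors-suc 0 ⟨
    #freeAncestors 1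
      ≡⟨ +-identityʳ (#freeAncestors 1) ⟨
    #freeAncestors 1 + 0
      ∎)
    where open ≤-Reasoning
  #free≤#freeAncestors (suc i) = begin
    #free                                                   ≤⟨ #free≤#freeAncestors i ⟩
    #freeAncestors (suc i) + i * #nonfree                   ≤⟨ +-monoˡ-≤ _ (#freeAncestors-step (suc i)) ⟩
    #freeAncestors (suc (suc i)) + #nonfree + i * #nonfree  ≡⟨ +-assoc _ #nonfree (i * #nonfree) ⟩
    #freeAncestors (suc (suc i)) + suc i * #nonfree         ∎
    where open ≤-Reasoning

  Free⇒¬covered : ∀ {v} → Free v → ¬ (Branching F v ⊎ v ∈ P)
  Free⇒¬covered (_ , outdeg≡1) (inj₁ branching) = 1+n≰n (subst (2 ≤_) outdeg≡1 (Branching⇒2≤outdeg F branching))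
  Free⇒¬covered (v∉P , _)      (inj₂ v∈P)       = v∉P v∈P

  module _ {k} (bpvc : IsBPVC F (suc k) P) where

    open Σ bpvc renaming (proj₁ to leaves∈P; proj₂ to cover)

    no-free-path : ∀ i {m} v (tl : Vec (Fin n) m) → i + suc m ≡ suc k →
                   DirPath F (v ∷ tl) → All Free (v ∷ tl) → ¬ FreeAncestors i v
    no-free-path zero v tl refl path free _ = lookupWith Free⇒¬covered free (cover (v ∷ tl) path)
    no-free-path (suc i) {m} v tl eq path free above
      with w , v-child , free-w , above-w ← Any-just above
      = no-free-path i w (v ∷ tl) (trans (+-suc i (suc m)) eq) (v-child , path) (free-w ∷ free) above-w

    leaf⇒∈P : ∀ v → outdeg F v ≡ 0 → v ∈ P
    leaf⇒∈P v = leaves∈P v ∘ outdeg≡0⇒Leaf F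

    ¬Free⇒∈P⊎branching : ∀ v → ¬ Free v → v ∈ P ⊎ 2 ≤ outdeg F v
    ¬Free⇒∈P⊎branching v ¬free with v ∈? P
    ... | yes v∈P = inj₁ v∈P
    ... | no  v∉P = [ inj₁ ∘ leaf⇒∈P v , inj₂ ]′ (≡0⊎2≤ (outdeg F v) (¬free ∘ (v∉P ,_)))
      where
      ≡0⊎2≤ : ∀ d → d ≢ 1 → d ≡ 0 ⊎ 2 ≤ d
      ≡0⊎2≤ 0             _   = inj₁ refl
      ≡0⊎2≤ 1             d≢1 = contradiction refl d≢1
      ≡0⊎2≤ (suc (suc d)) _   = inj₂ (s≤s (s≤s z≤n))

    #free≤k*#nonfree : #free ≤ k * #nonfree
    #free≤k*#nonfree = begin
      #free
        ≤⟨ #free≤#freeAncestors k ⟩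
      #freeAncestors (suc k) + k * #nonfree
        ≡⟨ cong (_+ k * #nonfree) (count-∅ no-free-chain (freeAncestors? (suc k))) ⟩
      k * #nonfree
        ∎
      where
      open ≤-Reasoning
      no-free-chain : ∀ u → ¬ FreeAncestors (suc k) u
      no-free-chain u above with w , _ , free-w , above-w ← Any-just above =
        no-free-path k w [] (+-comm k 1) _ (free-w ∷ []) above-w

    #nonfree≤∣P∣+#branch : #nonfree ≤ ∣ P ∣ + #branch
    #nonfree≤∣P∣+#branch = begin
      #nonfree                 ≤⟨ count-∪ ¬Free⇒∈P⊎branching (¬? ∘ free?) (_∈? P) (λ v → 2 ≤? outdeg F v) ⟩
      count (_∈? P) + #branch  ≡⟨ cong (_+ #branch) (∣p∣≡count P) ⟨
      ∣ P ∣ + #branch          ∎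
      where open ≤-Reasoning

    #branch<∣P∣ : Fin n → #branch < ∣ P ∣
    #branch<∣P∣ v₀ = begin-strict
      #branch                       <⟨ branchings<leaves F v₀ ⟩
      count (λ v → outdeg F v ≟ 0)  ≤⟨ count-mono leaf⇒∈P (λ v → outdeg F v ≟ 0) (_∈? P) ⟩
      count (_∈? P)                 ≡⟨ ∣p∣≡count P ⟨
      ∣ P ∣                         ∎
      where open ≤-Reasoning

    n+k≤2k∣P∣ : Fin n → n + suc k ≤ 2 * suc k * ∣ P ∣
    n+k≤2k∣P∣ v₀ = begin
      n + suc k                          ≡⟨ cong (_+ suc k) (count+count-complement free?) ⟨
      #free + #nonfree + suc k           ≤⟨ +-monoˡ-≤ (suc k) (+-monoˡ-≤ #nonfree #free≤k*#nonfree) ⟩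
      k * #nonfree + #nonfree + suc k    ≡⟨ regroup k #nonfree ⟩
      suc k * suc #nonfree               ≤⟨ *-monoʳ-≤ (suc k) (s≤s #nonfree≤∣P∣+#branch) ⟩
      suc k * suc (∣ P ∣ + #branch)      ≡⟨ cong (suc k *_) (+-suc ∣ P ∣ #branch) ⟨
      suc k * (∣ P ∣ + suc #branch)      ≤⟨ *-monoʳ-≤ (suc k) (+-monoʳ-≤ ∣ P ∣ (#branch<∣P∣ v₀)) ⟩
      suc k * (∣ P ∣ + ∣ P ∣)            ≡⟨ double (suc k) ∣ P ∣ ⟩
      2 * suc k * ∣ P ∣                  ∎
      where
      open ≤-Reasoning
      regroup : ∀ k d → k * d + d + suc k ≡ suc k * suc d
      regroup = solve-∀
      double : ∀ k m → k * (m + m) ≡ 2 * k * m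
      double = solve-∀

ancestor-descends : ∀ {n} (p : Fin n → Maybe (Fin n)) → (∀ u w → p u ≡ just w → w <ᶠ u) →
                    ∀ d v {w} → ancestor p d v ≡ just w → toℕ w + d ≤ toℕ v
ancestor-descends p decr zero    v refl = ≤-reflexive (+-identityʳ (toℕ v))
ancestor-descends p decr (suc d) v {w} eq with ancestor p d v in eq′
... | just w′ = begin
  toℕ w + suc d   ≡⟨ +-suc (toℕ w) d ⟩
  suc (toℕ w) + d ≤⟨ +-monoˡ-≤ d (decr w′ w eq) ⟩
  toℕ w′ + d      ≤⟨ ancestor-descends p decr d v eq′ ⟩
  toℕ v           ∎
  where open ≤-Reasoning

decreasingForest : ∀ {n} (p : Fin n → Maybe (Fin n)) → (∀ u w → p u ≡ just w → w <ᶠ u) → Forest n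
decreasingForest p decr = record { parent = p ; acyclic = λ v → suc (toℕ v) , reaches-root v }
  where
  reaches-root : ∀ v → ancestor p (suc (toℕ v)) v ≡ nothing
  reaches-root v with ancestor p (suc (toℕ v)) v in eq
  ... | nothing = refl
  ... | just w  = ⊥-elim (<⇒≱ (m≤n+m (suc (toℕ v)) (toℕ w)) (ancestor-descends p decr (suc (toℕ v)) v eq))

-- Subdivided combs

-- comb (r + 1) has a new root 0 whose children are a new leaf 1 and the root of comb r, shifted by 2.
combParent : ∀ r → Fin (suc (r * 2)) → Maybe (Fin (suc (r * 2)))
combParent r       zero          = nothing
combParent (suc r) (suc zero)    = just zero
combParent (suc r) (suc (suc u)) = just (maybe (λ w → suc (suc w)) zero (combParent r u))

combParent-decreasing : ∀ r u w → combParent r u ≡ just w → w <ᶠ u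
combParent-decreasing (suc r) (suc zero)    zero refl = s≤s z≤n
combParent-decreasing (suc r) (suc (suc u)) w    eq with combParent r u in eq′
... | nothing = subst (_<ᶠ suc (suc u)) (just-injective eq) (s≤s z≤n)
... | just w′ = subst (_<ᶠ suc (suc u)) (just-injective eq) (s≤s (s≤s (combParent-decreasing r u w′ eq′)))

comb : ∀ r → Forest (suc (r * 2))
comb r = decreasingForest (combParent r) (combParent-decreasing r)

combLeaf : ∀ r → Fin (suc r) → Fin (suc (r * 2))
combLeaf zero    zero    = zero
combLeaf (suc r) zero    = suc zero
combLeaf (suc r) (suc i) = suc (suc (combLeaf r i))

comb-branching-or-leaf : ∀ r s → Branching (comb r) s ⊎ ∃[ i ] s ≡ combLeaf r i
comb-branching-or-leaf zero    zero          = inj₂ (zero , refl)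
comb-branching-or-leaf (suc r) zero          = inj₁ (suc zero , suc (suc zero) , (λ ()) , refl , refl)
comb-branching-or-leaf (suc r) (suc zero)    = inj₂ (zero , refl)
comb-branching-or-leaf (suc r) (suc (suc s)) with comb-branching-or-leaf r s
... | inj₁ (u , w , u≢w , u-child , w-child) =
  inj₁ (suc (suc u) , suc (suc w) , u≢w ∘ suc-injective ∘ suc-injective , lift u-child , lift w-child)
  where
  lift : ∀ {u} → combParent r u ≡ just s → combParent (suc r) (suc (suc u)) ≡ just (suc (suc s))
  lift eq = cong (λ x → just (maybe (λ w → suc (suc w)) zero x)) eq
... | inj₂ (i , refl) = inj₂ (suc i , refl)

-- combine s t is the vertex at depth t on the path of k + 1 vertices that replaces s; the last one,
-- bottom s, takes over the children of s.
module Subdivision {m} (p : Fin m → Maybe (Fin m)) (p-decreasing : ∀ u w → p u ≡ just w → w <ᶠ u)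
                   (k : ℕ) where

  G : Forest m
  G = decreasingForest p p-decreasing

  bottom : Fin m → Fin (m * suc k)
  bottom s = combine s (fromℕ k)

  segmentParent : Fin m → Fin (suc k) → Maybe (Fin (m * suc k))
  segmentParent s zero    = Maybe.map bottom (p s)
  segmentParent s (suc t) = just (combine s (inject₁ t))

  subParent : Fin (m * suc k) → Maybe (Fin (m * suc k))
  subParent = uncurry segmentParent ∘ remQuot (suc k)

  subParent-combine : ∀ s t → subParent (combine s t) ≡ segmentParent s t
  subParent-combine s t = cong (uncurry segmentParent) (remQuot-combine s t)

  segmentParent-decreasing : ∀ s t {w} → segmentParent s t ≡ just w → w <ᶠ combine s t
  segmentParent-decreasing s zero    eq with s′ , ps , refl ← map≡just (p s) eq =
    combine-monoˡ-< (fromℕ k) zero (p-decreasing s s′ ps)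
  segmentParent-decreasing s (suc t) refl = begin-strict
    toℕ (combine s (inject₁ t))      ≡⟨ toℕ-combine s (inject₁ t) ⟩
    suc k * toℕ s + toℕ (inject₁ t)  ≡⟨ cong (suc k * toℕ s +_) (toℕ-inject₁ t) ⟩
    suc k * toℕ s + toℕ t            <⟨ +-monoʳ-< (suc k * toℕ s) ≤-refl ⟩
    suc k * toℕ s + suc (toℕ t)      ≡⟨ toℕ-combine s (suc t) ⟨
    toℕ (combine s (suc t))          ∎
    where open ≤-Reasoning

  subParent-decreasing : ∀ u w → subParent u ≡ just w → w <ᶠ u
  subParent-decreasing u w eq with s , t , refl ← combine-surjective {m} {suc k} u =
    segmentParent-decreasing s t (trans (sym (subParent-combine s t)) eq)

  subdivision : Forest (m * suc k)
  subdivision = decreasingForest subParent subParent-decreasing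

  private
    split : ∀ u → ∃[ s ] ∃[ t ] combine s t ≡ u
    split = combine-surjective {m} {suc k}

  child-in-segment : ∀ (s : Fin m) (t : Fin k) → Child subdivision (combine s (inject₁ t)) (combine s (suc t))
  child-in-segment s t = subParent-combine s (suc t)

  child-of-bottom : ∀ {s s′} → Child G s s′ → Child subdivision (bottom s) (combine s′ zero)
  child-of-bottom {s′ = s′} child = trans (subParent-combine s′ zero) (cong (Maybe.map bottom) child)

  only-child-in-segment : ∀ (s : Fin m) (t : Fin k) {u} →
                          Child subdivision (combine s (inject₁ t)) u → u ≡ combine s (suc t)
  only-child-in-segment s t {u} child with s′ , t′ , refl ← split u =
    inner-parent s′ t′ (trans (sym (subParent-combine s′ t′)) child)
    where
    inner-parent : ∀ s′ t′ → segmentParent s′ t′ ≡ just (combine s (inject₁ t)) →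
                   combine s′ t′ ≡ combine s (suc t)
    inner-parent s′ zero eq with s″ , _ , eq′ ← map≡just (p s′) eq =
      contradiction (proj₂ (combine-injective s″ (fromℕ k) s (inject₁ t) eq′)) fromℕ≢inject₁
    inner-parent s′ (suc t′) eq
      with refl , eq′ ← combine-injective s′ (inject₁ t′) s (inject₁ t) (just-injective eq)
      = cong (combine s ∘ suc) (inject₁-injective eq′)

  Branching-bottom : ∀ {s} → Branching G s → Branching subdivision (bottom s)
  Branching-bottom (u , w , u≢w , u-child , w-child) =
    combine u zero , combine w zero , u≢w ∘ combine-injectiveˡ u zero w zero ,
    child-of-bottom u-child , child-of-bottom w-child

  Leaf⇒bottom : ∀ u → Leaf subdivision u → ∃[ s ] (u ≡ bottom s × Leaf G s)
  Leaf⇒bottom u leaf with s , t , refl ← split u with view t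
  ... | ‵fromℕ          = s , refl , λ (s′ , child) → leaf (combine s′ zero , child-of-bottom child)
  ... | ‵inj₁ {i = t′} _ = contradiction (combine s (suc t′) , child-in-segment s t′) leaf

  bottom-on-path : ∀ {L} (s : Fin m) (t : Fin (suc k)) (tl : Vec (Fin (m * suc k)) L) →
                   DirPath subdivision (combine s t ∷ tl) → k ≤ toℕ t + L →
                   Any (λ v → ∃[ s ] v ≡ bottom s) (combine s t ∷ tl)
  bottom-on-path s t [] path k≤ with view t
  ... | ‵fromℕ           = here (s , refl)
  ... | ‵inj₁ {i = t′} _ = contradiction k≤ (<⇒≱ (begin-strict
    toℕ (inject₁ t′) + 0  ≡⟨ +-identityʳ (toℕ (inject₁ t′)) ⟩
    toℕ (inject₁ t′)      ≡⟨ toℕ-inject₁ t′ ⟩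
    toℕ t′                <⟨ toℕ<n t′ ⟩
    k                     ∎))
    where open ≤-Reasoning
  bottom-on-path {suc L} s t (u ∷ tl) (child , path) k≤ with view t
  ... | ‵fromℕ           = here (s , refl)
  ... | ‵inj₁ {i = t′} _ with refl ← only-child-in-segment s t′ child =
    there (bottom-on-path s (suc t′) tl path (subst (k ≤_) (begin-equality
      toℕ (inject₁ t′) + suc L  ≡⟨ +-suc (toℕ (inject₁ t′)) L ⟩
      suc (toℕ (inject₁ t′)) + L  ≡⟨ cong (λ x → suc x + L) (toℕ-inject₁ t′) ⟩
      suc (toℕ t′) + L  ∎) k≤))
    where open ≤-Reasoning

  module _ {L} (leaf : Fin L → Fin m) (branching-or-leaf : ∀ s → Branching G s ⊎ ∃[ i ] s ≡ leaf i) where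

    bottoms : Subset (m * suc k)
    bottoms = image (bottom ∘ leaf)

    bottom-covered : ∀ s → Branching subdivision (bottom s) ⊎ bottom s ∈ bottoms
    bottom-covered s with branching-or-leaf s
    ... | inj₁ branching = inj₁ (Branching-bottom branching)
    ... | inj₂ (i , refl) = inj₂ (∈-image (bottom ∘ leaf) i)

    subdivision-isBPVC : IsBPVC subdivision (suc k) bottoms
    subdivision-isBPVC = leaves∈bottoms , cover
      where
      leaves∈bottoms : ∀ u → Leaf subdivision u → u ∈ bottoms
      leaves∈bottoms u leafᵤ with s , refl , leafₛ ← Leaf⇒bottom u leafᵤ with bottom-covered s
      ... | inj₁ (v , _ , _ , child , _) = contradiction (v , child) leafᵤ
      ... | inj₂ ∈bottoms = ∈bottoms
      cover : ∀ vs → DirPath subdivision vs → Any (λ v → Branching subdivision v ⊎ v ∈ bottoms) vs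
      cover (v ∷ tl) path with s , t , refl ← split v =
        Any.map (λ { (s , refl) → bottom-covered s }) (bottom-on-path s t tl path (m≤n+m k (toℕ t)))

tight-cover⇒IsPsiB : ∀ {n k m} (F : Forest n) (P : Subset n) → Fin n → IsBPVC F (suc k) P →
                     ∣ P ∣ ≤ m → n + suc k ≡ 2 * suc k * m → IsPsiB F (suc k) m
tight-cover⇒IsPsiB {n} {k} {m} F P v₀ cover ∣P∣≤m n+k≡2km =
  (P , cover , ≤-antisym ∣P∣≤m (minimal P cover)) , minimal
  where
  minimal : ∀ P′ → IsBPVC F (suc k) P′ → m ≤ ∣ P′ ∣
  minimal P′ cover′ =
    *-cancelˡ-≤ (2 * suc k) (subst (_≤ 2 * suc k * ∣ P′ ∣) n+k≡2km (n+k≤2k∣P∣ F P′ cover′ v₀))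

combSubdivision : ∀ r k → Forest (suc (r * 2) * suc k)
combSubdivision r k = Subdivision.subdivision (combParent r) (combParent-decreasing r) k

combSubdivision-ψ : ∀ r k → IsPsiB (combSubdivision r k) (suc k) (suc r)
combSubdivision-ψ r k =
  tight-cover⇒IsPsiB (combSubdivision r k) (bottoms (combLeaf r) (comb-branching-or-leaf r)) zero
    (subdivision-isBPVC (combLeaf r) (comb-branching-or-leaf r)) (∣image∣≤ (bottom ∘ combLeaf r)) (size r k)
  where
  open Subdivision (combParent r) (combParent-decreasing r) k
  size : ∀ r k → suc (r * 2) * suc k + suc k ≡ 2 * suc k * suc r
  size = solve-∀

n+k≡[1+r]2k⇒n≡[1+2r]k : ∀ {n} k r → n + suc k ≡ suc r * (2 * suc k) → n ≡ suc (r * 2) * suc k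
n+k≡[1+r]2k⇒n≡[1+2r]k {n} k r eq = +-cancelʳ-≡ (suc k) n (suc (r * 2) * suc k) (trans eq (expand r k))
  where
  expand : ∀ r k → suc r * (2 * suc k) ≡ suc (r * 2) * suc k + suc k
  expand = solve-∀

theorem1 : (k : ℕ) → 2 ≤ k →
    ((n : ℕ) → 1 ≤ n → (F : Forest n) → (m : ℕ) → IsPsiB F k m →
       n + k ≤ 2 * k * m)
    ×
    ((n : ℕ) → 1 ≤ n → (2 * k) ∣ (n + k) →
       ∃[ F ] ∃[ m ] (IsPsiB {n} F k m × 2 * k * m ≡ n + k))
theorem1 (suc k) _ = lower-bound , tightness
  where
  lower-bound : (n : ℕ) → 1 ≤ n → (F : Forest n) → (m : ℕ) → IsPsiB F (suc k) m →
                n + suc k ≤ 2 * suc k * m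
  lower-bound (suc n) _ F _ ((P , cover , refl) , _) = n+k≤2k∣P∣ F P cover zero
  tightness : (n : ℕ) → 1 ≤ n → (2 * suc k) ∣ (n + suc k) →
              ∃[ F ] ∃[ m ] (IsPsiB {n} F (suc k) m × 2 * suc k * m ≡ n + suc k)
  tightness n _ (divides zero n+k≡0) = contradiction (trans (sym (+-suc n k)) n+k≡0) λ ()
  tightness n _ (divides (suc r) n+k≡) with refl ← n+k≡[1+r]2k⇒n≡[1+2r]k k r n+k≡ =
    combSubdivision r k , suc r , combSubdivision-ψ r k , trans (*-comm (2 * suc k) (suc r)) (sym n+k≡)
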